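{- Let $A$ be a circular $m\times n$ matrix, $b\in\mathbb{Z}^m_+$, and $\Gamma$ a circuit in $D(A)$ with $p(\Gamma)>0$. Then the $\Gamma$-inequality is valid for $Q^*(A,b)$.
   Context: $[n]=\{1,\dots,n\}$ with addition mod $n$ (node $0$ identified with $n$); $[a,c)_n$ denotes the cyclic interval $\{a,a+1,\dots,c-1\}$ mod $n$. A $\{0,1\}$ $m\times n$ matrix $A$ is circular if each row $i\in[m]$ is the incidence vector of $[\ell_i,\ell_i+k_i)_n$ for some $\ell_i,k_i\in[n]$ with $2\le k_i\le n-1$. $Q(A,b)=\{x\in\mathbb{R}^n:Ax\ge b,x\ge0\}$, $Q^*(A,b)=\mathrm{conv}(Q(A,b)\cap\mathbb{Z}^n)$. $D(A)$: node set $[n]$; forward row arcs $a_i=(\ell_i-1,\ell_i+k_i-1)$ (length $k_i$), forward short arcs $a_{m+j}=(j-1,j)$ (length 1), reverse row arcs $\bar a_i=(\ell_i+k_i-1,\ell_i-1)$ (length $-k_i$), reverse short arcs $\bar a_{m+j}=(j,j-1)$ (length $-1$), $i\in[m]$, $j\in[n]$. A circuit is a simple directed circuit; its winding number $p(\Gamma)$ satisfies $p(\Gamma)n=\sum_{a\in E(\Gamma)}l(a)$. A forward row arc $a_i$ jumps over $j$ iff $j\in[\ell_i,\ell_i+k_i)_n$; $(j-1,j)$ jumps over $j$ only; a reverse arc jumps over $j$ iff its antiparallel forward arc does; $p^-(\Gamma,j)$ is the number of reverse arcs of $\Gamma$ jumping over $j$. With $t(\Gamma,b)=\sum_{i:a_i\in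 E(\Gamma)}b_i-\sum_{i:\bar a_i\in E(\Gamma)}b_i$, $\beta=\lfloor t(\Gamma,b)/p(\Gamma)\rfloor$, $r=t(\Gamma,b)-\beta p(\Gamma)$, the $\Gamma$-inequality is $\sum_{j\in[n]}(p^-(\Gamma,j)+r)x_j\ge r(\beta+1)+\sum_{i:\bar a_i\in E(\Gamma)}b_i$. -}

module Defs where

open import Data.Nat as ℕ using (ℕ; zero; suc; NonZero; _<ᵇ_; _≡ᵇ_)
open import Data.Nat.DivMod using (_%_)
open import Data.Integer as ℤ using (ℤ; +_; -_; 0ℤ)
open import Data.Fin using (Fin; toℕ)
open import Data.Bool using (Bool; true; false; if_then_else_)
open import Data.List using (List; []; _∷_; map)
open import Data.List.Relation.Unary.Unique.Propositional using (Unique)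
open import Data.Unit using (⊤)
open import Data.Product using (_×_)
open import Relation.Binary.PropositionalEquality using (_≡_)

-- The cyclic set [n] = {1,…,n} (with 0 identified with n)
-- is represented by Fin n, an element v ∈ [n] being represented by
-- v mod n (so n ↦ 0).  Nodes of D(A) are handled as natural numbers
-- already reduced mod n.

Σℤ : ∀ {n} → (Fin n → ℤ) → ℤ
Σℤ {zero}  f = 0ℤ
Σℤ {suc n} f = f Fin.zero ℤ.+ Σℤ (λ j → f (Fin.suc j))
  where import Data.Fin as Fin

Σlist : ∀ {a} {A : Set a} → (A → ℤ) → List A → ℤ
Σlist f []       = 0ℤ
Σlist f (x ∷ xs) = f x ℤ.+ Σlist f xs

inCyc : (n : ℕ) .{{_ : NonZero n}} → Fin n → ℕ → Fin n → Bool
inCyc n a k j = ((toℕ j ℕ.+ (n ℕ.∸ toℕ a)) % n) <ᵇ k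

-- A circular m×n matrix, given by its rows: row i is the incidence
-- vector of [ℓ i, ℓ i + k i)_n with 2 ≤ k i ≤ n-1.
record Circular (m n : ℕ) : Set where
  field
    ℓ    : Fin m → Fin n
    k    : Fin m → ℕ
    k-lo : ∀ i → 2 ℕ.≤ k i
    k-hi : ∀ i → k i ℕ.≤ n ℕ.∸ 1

module _ {m n : ℕ} .{{_ : NonZero n}} (C : Circular m n) where
  open Circular C

  entry : Fin m → Fin n → Bool
  entry i j = inCyc n (ℓ i) (k i) j

  rowSum : (Fin n → ℤ) → Fin m → ℤ
  rowSum x i = Σℤ (λ j → if entry i j then x j else 0ℤ)

  InQ : (Fin m → ℕ) → (Fin n → ℤ) → Set
  InQ b x = (∀ i → + b i ℤ.≤ rowSum x i) × (∀ j → 0ℤ ℤ.≤ x j)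

  data Arc : Set where
    fwdRow   : Fin m → Arc
    fwdShort : Fin n → Arc
    revRow   : Fin m → Arc
    revShort : Fin n → Arc

  private
    md : ℕ → ℕ
    md v = v % n

  tail head : Arc → ℕ
  tail (fwdRow i)   = md (toℕ (ℓ i) ℕ.+ n ℕ.∸ 1)
  tail (fwdShort j) = md (toℕ j ℕ.+ n ℕ.∸ 1)
  tail (revRow i)   = md (toℕ (ℓ i) ℕ.+ k i ℕ.+ n ℕ.∸ 1)
  tail (revShort j) = md (toℕ j)
  head (fwdRow i)   = md (toℕ (ℓ i) ℕ.+ k i ℕ.+ n ℕ.∸ 1)
  head (fwdShort j) = md (toℕ j)
  head (revRow i)   = md (toℕ (ℓ i) ℕ.+ n ℕ.∸ 1)
  head (revShort j) = md (toℕ j ℕ.+ n ℕ.∸ 1)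

  len : Arc → ℤ
  len (fwdRow i)   = + k i
  len (fwdShort j) = + 1
  len (revRow i)   = - + k i
  len (revShort j) = - + 1

  jumps : Arc → Fin n → Bool
  jumps (fwdRow i)   j = entry i j
  jumps (fwdShort j′) j = toℕ j′ ≡ᵇ toℕ j
  jumps (revRow i)   j = entry i j
  jumps (revShort j′) j = toℕ j′ ≡ᵇ toℕ j

  isReverse : Arc → Bool
  isReverse (revRow _)   = true
  isReverse (revShort _) = true
  isReverse _            = false

  Path : Arc → List Arc → Set
  Path e []       = ⊤
  Path e (f ∷ fs) = head e ≡ tail f × Path f fs

  lastArc : Arc → List Arc → Arc
  lastArc e []       = e
  lastArc e (f ∷ fs) = lastArc f fs

  record Circuit : Set where
    field
      first  : Arc
      rest   : List Arc
      path   : Path first rest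
      closed : head (lastArc first rest) ≡ tail first
      simple : Unique (map tail (first ∷ rest))

  arcs : Circuit → List Arc
  arcs Γ = Circuit.first Γ ∷ Circuit.rest Γ

  -- total length Σ_{a ∈ E(Γ)} l(a)  (= p(Γ)·n)
  totalLen : Circuit → ℤ
  totalLen Γ = Σlist len (arcs Γ)

  tΓ : Circuit → (Fin m → ℕ) → ℤ
  tΓ Γ b = Σlist f (arcs Γ)
    where
    f : Arc → ℤ
    f (fwdRow i) = + b i
    f (revRow i) = - + b i
    f _          = 0ℤ

  revRowB : Circuit → (Fin m → ℕ) → ℤ
  revRowB Γ b = Σlist f (arcs Γ)
    where
    f : Arc → ℤ
    f (revRow i) = + b i
    f _          = 0ℤ

  pMinus : Circuit → Fin n → ℤ
  pMinus Γ j = Σlist (λ e → if isReverse e then (if jumps e j then + 1 else 0ℤ) else 0ℤ) (arcs Γ)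

{-# OPTIONS --safe #-}
-- Fix a node j and place every node v of D(A) at its representative lift j v in the window
-- [j, j + n).  Along a forward arc of length k the lifted position advances by k, minus n
-- exactly when the arc jumps over j; reverse arcs undo this.  Around the closed circuit the
-- positions telescope, so n times the net number of jumps over j is the total length p n:
-- forward arcs of Γ jump over every j exactly p + p⁻(Γ,j) times.  Weighting by an integer
-- point x of Q(A,b) therefore gives R := Σⱼ p⁻(Γ,j) xⱼ ≥ B := Σ_{āᵢ ∈ Γ} bᵢ and
-- R + p Σⱼ xⱼ ≥ Σ_{aᵢ ∈ Γ} bᵢ = t + B.  Writing t = βp + r, these two inequalities give
-- r(β + 1) + B ≤ R + r Σⱼ xⱼ by splitting on Σⱼ xⱼ ≤ β (mixed-integer rounding).
module Submission where

open import Defs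
open import Data.Nat as ℕ using (ℕ; NonZero; _>_)
open import Data.Integer as ℤ using (ℤ; +_; _/ℕ_; _%ℕ_)
open import Data.Fin using (Fin)
open import Relation.Binary.PropositionalEquality using (_≡_; sym; subst)
open import Data.Product using (_,_)

module NatCyclic where
  open import Data.Bool using (T; true; false; if_then_else_)
  open import Data.Nat
  open import Data.Nat.DivMod
  open import Data.Nat.Properties
  open import Algebra.Properties.CommutativeSemigroup +-commutativeSemigroup
    using (xy∙z≈xz∙y; x∙yz≈y∙xz)
  open import Data.Nat.Tactic.RingSolver using (solve-∀)
  open import Relation.Nullary using (yes; no; contradiction)
  open import Relation.Nullary.Reflects using (ofʸ; ofⁿ; det; fromEquivalence)
  open import Relation.Binary.PropositionalEquality

  [m%n+k]%n≡[m+k]%n : ∀ m k n .{{_ : NonZero n}} → (m % n + k) % n ≡ (m + k) % n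
  [m%n+k]%n≡[m+k]%n m k n = begin
    (m % n + k) % n          ≡⟨ %-distribˡ-+ (m % n) k n ⟩
    (m % n % n + k % n) % n  ≡⟨ cong (λ w → (w + k % n) % n) (m%n%n≡m%n m n) ⟩
    (m % n + k % n) % n      ≡⟨ %-distribˡ-+ m k n ⟨
    (m + k) % n              ∎
    where open ≡-Reasoning

  module CyclicLift (n′ : ℕ) where

    n : ℕ
    n = suc n′

    lift : ℕ → ℕ → ℕ
    lift a v = v + (if v <ᵇ a then n else 0)

    lift-below : ∀ {a v} → v < a → lift a v ≡ v + n
    lift-below {a} {v} v<a with v <ᵇ a | <ᵇ-reflects-< v a
    ... | true  | _        = refl
    ... | false | ofⁿ v≮a = contradiction v<a v≮a

    lift-above : ∀ {a v} → a ≤ v → lift a v ≡ v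
    lift-above {a} {v} a≤v with v <ᵇ a | <ᵇ-reflects-< v a
    ... | true  | ofʸ v<a = contradiction a≤v (<⇒≱ v<a)
    ... | false | _        = +-identityʳ v

    lift-% : ∀ a {v} → v < n → lift a v % n ≡ v
    lift-% a {v} v<n with v <? a
    ... | yes v<a rewrite lift-below v<a = trans ([m+n]%n≡m%n v n) (m<n⇒m%n≡m v<n)
    ... | no  v≮a rewrite lift-above (≮⇒≥ v≮a) = m<n⇒m%n≡m v<n

    lift-≥ : ∀ {a} v → a ≤ n → a ≤ lift a v
    lift-≥ {a} v a≤n with v <? a
    ... | yes v<a rewrite lift-below v<a = ≤-trans a≤n (m≤n+m n v)
    ... | no  v≮a rewrite lift-above (≮⇒≥ v≮a) = ≮⇒≥ v≮a

    lift-< : ∀ a {v} → v < n → lift a v < a + n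
    lift-< a {v} v<n with v <? a
    ... | yes v<a rewrite lift-below v<a = +-monoˡ-< n v<a
    ... | no  v≮a rewrite lift-above (≮⇒≥ v≮a) = <-≤-trans v<n (m≤n+m n a)

    lift-unique : ∀ {a u} → a ≤ n → a ≤ u → u < a + n → lift a (u % n) ≡ u
    lift-unique {a} {u} a≤n a≤u u<a+n with u <? n
    ... | yes u<n rewrite m<n⇒m%n≡m u<n = lift-above a≤u
    ... | no  u≮n = begin
      lift a (u % n)        ≡⟨ cong (lift a) (sym (m≤n⇒[n∸m]%m≡n%m n≤u)) ⟩
      lift a ((u ∸ n) % n)  ≡⟨ cong (lift a) (m<n⇒m%n≡m (<-≤-trans u∸n<a a≤n)) ⟩
      lift a (u ∸ n)        ≡⟨ lift-below u∸n<a ⟩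
      u ∸ n + n             ≡⟨ m∸n+n≡m n≤u ⟩
      u                     ∎
      where
      open ≡-Reasoning
      n≤u : n ≤ u
      n≤u = ≮⇒≥ u≮n
      u∸n<a : u ∸ n < a
      u∸n<a = subst (u ∸ n <_) (m+n∸n≡m a n) (∸-monoˡ-< u<a+n n≤u)

    lift-complement : ∀ a v → lift a v + lift (suc v) a ≡ v + a + n
    lift-complement a v with v <? a
    ... | yes v<a rewrite lift-below v<a | lift-above v<a = xy∙z≈xz∙y v n a
    ... | no  v≮a rewrite lift-above (≮⇒≥ v≮a) | lift-below (s≤s (≮⇒≥ v≮a)) = sym (+-assoc v a n)

    lift-wrap : ∀ {a u} → a ≤ n → a + n ≤ u → u < a + n + n → lift a (u % n) + n ≡ u
    lift-wrap {a} {u} a≤n a+n≤u u<a+n+n = begin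
      lift a (u % n) + n         ≡⟨ cong (λ w → lift a w + n) (sym (m≤n⇒[n∸m]%m≡n%m n≤u)) ⟩
      lift a ((u ∸ n) % n) + n   ≡⟨ cong (_+ n) (lift-unique a≤n a≤u∸n u∸n<a+n) ⟩
      u ∸ n + n                  ≡⟨ m∸n+n≡m n≤u ⟩
      u                          ∎
      where
      open ≡-Reasoning
      n≤u : n ≤ u
      n≤u = ≤-trans (m≤n+m n a) a+n≤u
      a≤u∸n : a ≤ u ∸ n
      a≤u∸n = subst (_≤ u ∸ n) (m+n∸n≡m a n) (∸-monoˡ-≤ n a+n≤u)
      u∸n<a+n : u ∸ n < a + n
      u∸n<a+n = subst (u ∸ n <_) (m+n∸n≡m (a + n) n) (∸-monoˡ-< u<a+n+n n≤u)

    -- The cyclic distance from a to j: inCyc n a k j is offset (toℕ a) (toℕ j) <ᵇ k.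
    offset : ℕ → ℕ → ℕ
    offset a j = (j + (n ∸ a)) % n

    cyclicPred : ℕ → ℕ
    cyclicPred ℓ = (ℓ + n ∸ 1) % n

    cyclicPred<n : ∀ ℓ → cyclicPred ℓ < n
    cyclicPred<n ℓ = m%n<n (ℓ + n ∸ 1) n

    offset-lift : ∀ {a j} → a ≤ n → j < n → a + offset a j ≡ lift a j
    offset-lift {a} {j} a≤n j<n with j <? a
    ... | yes j<a rewrite lift-below j<a = begin
      a + (j + (n ∸ a)) % n  ≡⟨ cong (_+_ a) (m<n⇒m%n≡m j+[n∸a]<n) ⟩
      a + (j + (n ∸ a))      ≡⟨ x∙yz≈y∙xz a j (n ∸ a) ⟩
      j + (a + (n ∸ a))      ≡⟨ cong (_+_ j) (m+[n∸m]≡n a≤n) ⟩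
      j + n                  ∎
      where
      open ≡-Reasoning
      j+[n∸a]<n : j + (n ∸ a) < n
      j+[n∸a]<n = subst (j + (n ∸ a) <_) (m+[n∸m]≡n a≤n) (+-monoˡ-< (n ∸ a) j<a)
    ... | no j≮a rewrite lift-above (≮⇒≥ j≮a) = begin
      a + (j + (n ∸ a)) % n  ≡⟨ cong (λ w → a + w % n) (trans (sym (+-∸-assoc j a≤n)) (+-∸-comm n a≤j)) ⟩
      a + (j ∸ a + n) % n    ≡⟨ cong (_+_ a) ([m+n]%n≡m%n (j ∸ a) n) ⟩
      a + (j ∸ a) % n        ≡⟨ cong (_+_ a) (m<n⇒m%n≡m (≤-<-trans (m∸n≤m j a) j<n)) ⟩
      a + (j ∸ a)            ≡⟨ m+[n∸m]≡n a≤j ⟩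
      j                      ∎
      where
      open ≡-Reasoning
      a≤j : a ≤ j
      a≤j = ≮⇒≥ j≮a

    offset-suc-cyclicPred : ∀ {ℓ} j → ℓ < n → offset (suc (cyclicPred ℓ)) j ≡ offset ℓ j
    offset-suc-cyclicPred {zero} j _ rewrite m<n⇒m%n≡m (n<1+n n′) | n∸n≡0 n′ =
      trans (cong (_% n) (+-identityʳ j)) (sym ([m+n]%n≡m%n j n))
    offset-suc-cyclicPred {suc ℓ} j ℓ<n =
      cong (λ t → offset (suc t) j) (trans ([m+n]%n≡m%n ℓ n) (m<n⇒m%n≡m (<⇒≤ ℓ<n)))

    offset-complement : ∀ {ℓ j} → ℓ < n → j < n → lift j (cyclicPred ℓ) + offset ℓ j ≡ j + n′
    offset-complement {ℓ} {j} ℓ<n j<n = +-cancelʳ-≡ (suc t) _ _ (begin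
      lift j t + offset ℓ j + suc t
        ≡⟨ +-assoc (lift j t) _ _ ⟩
      lift j t + (offset ℓ j + suc t)
        ≡⟨ cong (λ w → lift j t + (w + suc t)) (offset-suc-cyclicPred j ℓ<n) ⟨
      lift j t + (offset (suc t) j + suc t)
        ≡⟨ cong (_+_ (lift j t)) (trans (+-comm _ (suc t)) (offset-lift (cyclicPred<n ℓ) j<n)) ⟩
      lift j t + lift (suc t) j
        ≡⟨ lift-complement j t ⟩
      t + j + n
        ≡⟨ rearrange t j n′ ⟩
      j + n′ + suc t ∎)
      where
      open ≡-Reasoning
      t = cyclicPred ℓ
      rearrange : ∀ t j n′ → t + j + suc n′ ≡ j + n′ + suc t
      rearrange = solve-∀

    -- off is the distance from v + 1 to j (offset-complement), so the arc of length k out of v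
    -- jumps over j iff off < k, which is exactly when lift j v + k leaves the window of j.
    lift-+ : ∀ {j v k off} → j < n → v < n → k ≤ n → lift j v + off ≡ j + n′ →
             lift j v + k ≡ lift j ((lift j v + k) % n) + (if off <ᵇ k then n else 0)
    lift-+ {j} {v} {k} {off} j<n v<n k≤n complement with off <ᵇ k | <ᵇ-reflects-< off k
    ... | true  | ofʸ off<k = sym (lift-wrap (<⇒≤ j<n) j+n≤u u<j+n+n)
      where
      j+n≤u : j + n ≤ lift j v + k
      j+n≤u = begin
        j + n                 ≡⟨ +-suc j n′ ⟩
        suc (j + n′)          ≡⟨ cong suc complement ⟨
        suc (lift j v + off)  ≡⟨ +-suc (lift j v) off ⟨
        lift j v + suc off    ≤⟨ +-monoʳ-≤ (lift j v) off<k ⟩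
        lift j v + k          ∎
        where open ≤-Reasoning
      u<j+n+n : lift j v + k < j + n + n
      u<j+n+n = +-mono-<-≤ (lift-< j v<n) k≤n
    ... | false | ofⁿ off≮k = sym (trans (+-identityʳ _) (lift-unique (<⇒≤ j<n) j≤u u<j+n))
      where
      j≤u : j ≤ lift j v + k
      j≤u = ≤-trans (lift-≥ v (<⇒≤ j<n)) (m≤m+n _ k)
      u<j+n : lift j v + k < j + n
      u<j+n = begin-strict
        lift j v + k   ≤⟨ +-monoʳ-≤ (lift j v) (≮⇒≥ off≮k) ⟩
        lift j v + off ≡⟨ complement ⟩
        j + n′         <⟨ +-monoʳ-< j (n<1+n n′) ⟩
        j + n          ∎
        where open ≤-Reasoning

    arc-crossing : ∀ {ℓ k j} → ℓ < n → k ≤ n → j < n →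
      k + lift j (cyclicPred ℓ) ≡ lift j ((ℓ + k + n ∸ 1) % n) + (if offset ℓ j <ᵇ k then n else 0)
    arc-crossing {ℓ} {k} {j} ℓ<n k≤n j<n = begin
      k + lift j t                         ≡⟨ +-comm k _ ⟩
      lift j t + k                         ≡⟨ lift-+ j<n (cyclicPred<n ℓ) k≤n (offset-complement ℓ<n j<n) ⟩
      lift j ((lift j t + k) % n) + jump   ≡⟨ cong (λ h → lift j h + jump) head≡ ⟨
      lift j ((ℓ + k + n ∸ 1) % n) + jump  ∎
      where
      open ≡-Reasoning
      t = cyclicPred ℓ
      jump = if offset ℓ j <ᵇ k then n else 0
      head≡ : (ℓ + k + n ∸ 1) % n ≡ (lift j t + k) % n
      head≡ = begin
        (ℓ + k + n ∸ 1) % n       ≡⟨ cong (λ w → (w ∸ 1) % n) (xy∙z≈xz∙y ℓ k n) ⟩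
        (ℓ + n + k ∸ 1) % n       ≡⟨ cong (_% n) (+-∸-comm k (≤-trans (s≤s z≤n) (m≤n+m n ℓ))) ⟩
        (ℓ + n ∸ 1 + k) % n       ≡⟨ [m%n+k]%n≡[m+k]%n (ℓ + n ∸ 1) k n ⟨
        (t + k) % n               ≡⟨ cong (λ w → (w + k) % n) (lift-% j (cyclicPred<n ℓ)) ⟨
        (lift j t % n + k) % n    ≡⟨ [m%n+k]%n≡[m+k]%n (lift j t) k n ⟩
        (lift j t + k) % n        ∎

    offset-self : ∀ {j} → j ≤ n → offset j j ≡ 0
    offset-self j≤n = trans (cong (_% n) (m+[n∸m]≡n j≤n)) (n%n≡0 n)

    offset≡0⇒≡ : ∀ {c j} → c < n → j < n → offset c j ≡ 0 → c ≡ j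
    offset≡0⇒≡ {c} {j} c<n j<n off≡0 = fixed-point (begin
      c                 ≡⟨ +-identityʳ c ⟨
      c + 0             ≡⟨ cong (_+_ c) off≡0 ⟨
      c + offset c j    ≡⟨ offset-lift (<⇒≤ c<n) j<n ⟩
      lift c j          ∎)
      where
      open ≡-Reasoning
      fixed-point : c ≡ lift c j → c ≡ j
      fixed-point c≡lift with j <? c
      ... | yes j<c = contradiction (subst (n ≤_) (sym (trans c≡lift (lift-below j<c))) (m≤n+m n j)) (<⇒≱ c<n)
      ... | no  j≮c = trans c≡lift (lift-above (≮⇒≥ j≮c))

    offset<ᵇ1≡≡ᵇ : ∀ {c j} → c < n → j < n → (offset c j <ᵇ 1) ≡ (c ≡ᵇ j)
    offset<ᵇ1≡≡ᵇ {c} {j} c<n j<n = det (<ᵇ-reflects-< (offset c j) 1) (fromEquivalence from to)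
      where
      from : T (c ≡ᵇ j) → offset c j < 1
      from t with ≡ᵇ⇒≡ c j t
      ... | refl = ≤-reflexive (cong suc (offset-self (<⇒≤ c<n)))
      to : offset c j < 1 → T (c ≡ᵇ j)
      to off<1 = ≡⇒≡ᵇ c j (offset≡0⇒≡ c<n j<n (n<1⇒n≡0 off<1))

    short-crossing : ∀ {c j} → c < n → j < n →
      1 + lift j (cyclicPred c) ≡ lift j (c % n) + (if c ≡ᵇ j then n else 0)
    short-crossing {c} {j} c<n j<n =
      trans (arc-crossing c<n (s≤s z≤n) j<n)
            (cong₂ (λ h b → lift j h + (if b then n else 0)) head≡ (offset<ᵇ1≡≡ᵇ c<n j<n))
      where
      head≡ : (c + 1 + n ∸ 1) % n ≡ c % n
      head≡ = trans (cong (λ w → (w ∸ 1) % n) (trans (+-assoc c 1 n) (+-suc c n))) ([m+n]%n≡m%n c n)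

module IntegerSums where
  open import Data.Fin using (zero; suc)
  open import Data.Integer hiding (suc)
  open import Data.Integer.Properties
  open import Algebra.Properties.CommutativeSemigroup +-commutativeSemigroup using (interchange)
  open import Data.List using ([]; _∷_)
  open import Relation.Binary.PropositionalEquality

  module _ {a} {A : Set a} where

    Σlist-cong : ∀ {f g : A → ℤ} xs → (∀ x → f x ≡ g x) → Σlist f xs ≡ Σlist g xs
    Σlist-cong []       f≗g = refl
    Σlist-cong (x ∷ xs) f≗g = cong₂ _+_ (f≗g x) (Σlist-cong xs f≗g)

    Σlist-mono : ∀ {f g : A → ℤ} xs → (∀ x → f x ≤ g x) → Σlist f xs ≤ Σlist g xs
    Σlist-mono []       f≤g = ≤-refl
    Σlist-mono (x ∷ xs) f≤g = +-mono-≤ (f≤g x) (Σlist-mono xs f≤g)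

    Σlist-+ : ∀ (f g : A → ℤ) xs → Σlist (λ x → f x + g x) xs ≡ Σlist f xs + Σlist g xs
    Σlist-+ f g []       = refl
    Σlist-+ f g (x ∷ xs) =
      trans (cong (_+_ (f x + g x)) (Σlist-+ f g xs)) (interchange (f x) (g x) _ _)

    Σlist-*ʳ : ∀ (f : A → ℤ) c xs → Σlist (λ x → f x * c) xs ≡ Σlist f xs * c
    Σlist-*ʳ f c []       = refl
    Σlist-*ʳ f c (x ∷ xs) =
      trans (cong (_+_ (f x * c)) (Σlist-*ʳ f c xs)) (sym (*-distribʳ-+ c (f x) (Σlist f xs)))

  Σℤ-cong : ∀ {n} {f g : Fin n → ℤ} → (∀ j → f j ≡ g j) → Σℤ f ≡ Σℤ g
  Σℤ-cong {ℕ.zero}  f≗g = refl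
  Σℤ-cong {ℕ.suc n} f≗g = cong₂ _+_ (f≗g zero) (Σℤ-cong (λ j → f≗g (suc j)))

  Σℤ-nonneg : ∀ {n} {f : Fin n → ℤ} → (∀ j → 0ℤ ≤ f j) → 0ℤ ≤ Σℤ f
  Σℤ-nonneg {ℕ.zero}  0≤f = ≤-refl
  Σℤ-nonneg {ℕ.suc n} 0≤f = +-mono-≤ (0≤f zero) (Σℤ-nonneg (λ j → 0≤f (suc j)))

  Σℤ-zero : ∀ n → Σℤ {n} (λ _ → 0ℤ) ≡ 0ℤ
  Σℤ-zero ℕ.zero    = refl
  Σℤ-zero (ℕ.suc n) = trans (+-identityˡ _) (Σℤ-zero n)

  Σℤ-+ : ∀ {n} (f g : Fin n → ℤ) → Σℤ (λ j → f j + g j) ≡ Σℤ f + Σℤ g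
  Σℤ-+ {ℕ.zero}  f g = refl
  Σℤ-+ {ℕ.suc n} f g =
    trans (cong (_+_ (f zero + g zero)) (Σℤ-+ (λ j → f (suc j)) (λ j → g (suc j))))
          (interchange (f zero) (g zero) _ _)

  Σℤ-*ˡ : ∀ {n} c (f : Fin n → ℤ) → Σℤ (λ j → c * f j) ≡ c * Σℤ f
  Σℤ-*ˡ {ℕ.zero}  c f = sym (*-zeroʳ c)
  Σℤ-*ˡ {ℕ.suc n} c f =
    trans (cong (_+_ (c * f zero)) (Σℤ-*ˡ c (λ j → f (suc j)))) (sym (*-distribˡ-+ c (f zero) _))

  Σℤ-Σlist-comm : ∀ {a} {A : Set a} {n} (F : A → Fin n → ℤ) xs →
    Σℤ (λ j → Σlist (λ x → F x j) xs) ≡ Σlist (λ x → Σℤ (F x)) xs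
  Σℤ-Σlist-comm {n = n} F []       = Σℤ-zero n
  Σℤ-Σlist-comm         F (x ∷ xs) =
    trans (Σℤ-+ (F x) (λ j → Σlist (λ y → F y j) xs)) (cong (_+_ (Σℤ (F x))) (Σℤ-Σlist-comm F xs))

  Σlist-Σℤ-weighted : ∀ {a} {A : Set a} {n} (c : A → Fin n → ℤ) (y : Fin n → ℤ) xs →
    Σlist (λ x → Σℤ (λ j → c x j * y j)) xs ≡ Σℤ (λ j → Σlist (λ x → c x j) xs * y j)
  Σlist-Σℤ-weighted c y xs =
    trans (sym (Σℤ-Σlist-comm (λ x j → c x j * y j) xs))
          (Σℤ-cong (λ j → Σlist-*ʳ (λ x → c x j) (y j) xs))

  Σℤ-affine : ∀ {n} (P : Fin n → ℤ) c (y : Fin n → ℤ) →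
    Σℤ (λ j → (P j + c) * y j) ≡ Σℤ (λ j → P j * y j) + c * Σℤ y
  Σℤ-affine P c y =
    trans (Σℤ-cong (λ j → *-distribʳ-+ (y j) (P j) c))
          (trans (Σℤ-+ (λ j → P j * y j) (λ j → c * y j))
                 (cong (_+_ (Σℤ (λ j → P j * y j))) (Σℤ-*ˡ c y)))

module IntegerRounding where
  open import Data.Integer hiding (suc)
  open import Data.Integer.Properties
  open import Data.Integer.DivMod using (a≡a%ℕn+[a/ℕn]*n; n%ℕd<d)
  open import Data.Integer.Tactic.RingSolver using (solve-∀)
  import Data.Nat.Properties as ℕP
  open import Relation.Nullary using (yes; no)
  open import Relation.Binary.PropositionalEquality

  *-nonneg : ∀ {i j} → 0ℤ ≤ i → 0ℤ ≤ j → 0ℤ ≤ i * j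
  *-nonneg {i} {j} 0≤i 0≤j = subst (_≤ i * j) (*-zeroʳ i) (*-monoˡ-≤-nonNeg i {{nonNegative 0≤i}} 0≤j)

  mixed-integer-rounding : ∀ p .{{_ : ℕ.NonZero p}} {t B R T : ℤ} → B ≤ R → t + B ≤ R + + p * T →
    + (t %ℕ p) * (t /ℕ p + + 1) + B ≤ R + + (t %ℕ p) * T
  mixed-integer-rounding p {t} {B} {R} {T} B≤R t+B≤R+pT with T ≤? t /ℕ p
  ... | yes T≤β = 0≤i-j⇒j≤i (subst (0ℤ ≤_) (sym slack)
          (+-mono-≤ (i≤j⇒0≤j-i t+B≤R+pT) (*-nonneg (i≤j⇒0≤j-i r≤p) (i≤j⇒0≤j-i T≤β))))
    where
    r = + (t %ℕ p)
    β = t /ℕ p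
    r≤p : r ≤ + p
    r≤p = +≤+ (ℕP.<⇒≤ (n%ℕd<d t p))
    identity : ∀ p r β T B R →
      R + r * T - (r * (β + + 1) + B) ≡ (R + p * T - ((r + β * p) + B)) + (p - r) * (β - T)
    identity = solve-∀
    slack : R + r * T - (r * (β + + 1) + B) ≡ (R + + p * T - (t + B)) + (+ p - r) * (β - T)
    slack = trans (identity (+ p) r β T B R)
                  (cong (λ u → (R + + p * T - (u + B)) + (+ p - r) * (β - T)) (sym (a≡a%ℕn+[a/ℕn]*n t p)))
  ... | no T≰β = subst (_ ≤_) (+-comm _ R) (+-mono-≤ (*-monoˡ-≤-nonNeg (+ (t %ℕ p)) β+1≤T) B≤R)
    where
    β+1≤T : t /ℕ p + + 1 ≤ T
    β+1≤T = subst (_≤ T) (+-comm (+ 1) (t /ℕ p)) (i<j⇒suc[i]≤j (≰⇒> T≰β))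

module Crossings {m n′ : ℕ} (C : Circular m (ℕ.suc n′)) where
  open import Data.Bool using (Bool; true; false; if_then_else_)
  open import Data.Fin using (toℕ)
  open import Data.Fin.Properties using (toℕ<n)
  open import Data.Integer hiding (suc)
  open import Data.Integer.Properties
  import Data.Nat.Properties as ℕP
  open import Data.Integer.Tactic.RingSolver using (solve-∀)
  open import Data.List using ([]; _∷_)
  open import Data.Product using (_,_)
  open import Relation.Binary.PropositionalEquality
  open Circular C
  open IntegerSums
  open IntegerRounding using (*-nonneg)
  open NatCyclic.CyclicLift n′ using (n; lift; arc-crossing; short-crossing)

  ⟦_⟧ : Bool → ℤ
  ⟦ J ⟧ = if J then + 1 else 0ℤ

  forwardJump reverseJump : Arc C → Fin n → ℤ
  forwardJump e j = if isReverse C e then 0ℤ else ⟦ jumps C e j ⟧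
  reverseJump e j = if isReverse C e then ⟦ jumps C e j ⟧ else 0ℤ

  ⟦⟧-nonneg : ∀ J → 0ℤ ≤ ⟦ J ⟧
  ⟦⟧-nonneg true  = +≤+ ℕ.z≤n
  ⟦⟧-nonneg false = +≤+ ℕ.z≤n

  forwardJump-nonneg : ∀ e j → 0ℤ ≤ forwardJump e j
  forwardJump-nonneg e j with isReverse C e
  ... | true  = ≤-refl
  ... | false = ⟦⟧-nonneg (jumps C e j)

  reverseJump-nonneg : ∀ e j → 0ℤ ≤ reverseJump e j
  reverseJump-nonneg e j with isReverse C e
  ... | true  = ⟦⟧-nonneg (jumps C e j)
  ... | false = ≤-refl

  potential : Fin n → ℕ → ℤ
  potential j v = + lift (toℕ j) v

  row-crossing : ∀ i j → k i ℕ.+ lift (toℕ j) (tail C (fwdRow i))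
                         ≡ lift (toℕ j) (head C (fwdRow i)) ℕ.+ (if entry C i j then n else 0)
  row-crossing i j = arc-crossing (toℕ<n (ℓ i)) (ℕP.m≤n⇒m≤1+n (k-hi i)) (toℕ<n j)

  ⟦⟧-scale : ∀ J → + (if J then n else 0) ≡ ⟦ J ⟧ * + n
  ⟦⟧-scale true  = sym (*-identityˡ (+ n))
  ⟦⟧-scale false = refl

  forward-drop : ∀ J k {a b} → k ℕ.+ a ≡ b ℕ.+ (if J then n else 0) →
                 + k + + a - + b ≡ (⟦ J ⟧ - 0ℤ) * + n
  forward-drop J k {a} {b} eq = begin
    + k + + a - + b                              ≡⟨ cong (_- + b) (trans (sym (pos-+ k a)) (cong +_ eq)) ⟩
    + (b ℕ.+ (if J then n else 0)) - + b          ≡⟨ cong (_- + b) (pos-+ b _) ⟩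
    + b + + (if J then n else 0) - + b            ≡⟨ cancel (+ b) _ ⟩
    + (if J then n else 0)                        ≡⟨ ⟦⟧-scale J ⟩
    ⟦ J ⟧ * + n                                   ≡⟨ cong (_* + n) (+-identityʳ ⟦ J ⟧) ⟨
    (⟦ J ⟧ - 0ℤ) * + n                            ∎
    where
    open ≡-Reasoning
    cancel : ∀ x y → x + y - x ≡ y
    cancel = solve-∀

  reverse-drop : ∀ J k {a b} → k ℕ.+ a ≡ b ℕ.+ (if J then n else 0) →
                 - + k + + b - + a ≡ (0ℤ - ⟦ J ⟧) * + n
  reverse-drop J k {a} {b} eq =
    trans (negate (+ k) (+ a) (+ b)) (trans (cong -_ (forward-drop J k eq)) (flip ⟦ J ⟧ (+ n)))
    where
    negate : ∀ x y z → - x + z - y ≡ - (x + y - z)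
    negate = solve-∀
    flip : ∀ u v → - ((u - 0ℤ) * v) ≡ (0ℤ - u) * v
    flip = solve-∀

  potential-drop : ∀ j e → len C e + potential j (tail C e) - potential j (head C e)
                           ≡ (forwardJump e j - reverseJump e j) * + n
  potential-drop j (fwdRow i)   = forward-drop (entry C i j) (k i) (row-crossing i j)
  potential-drop j (revRow i)   = reverse-drop (entry C i j) (k i) (row-crossing i j)
  potential-drop j (fwdShort c) = forward-drop (toℕ c ℕ.≡ᵇ toℕ j) 1 (short-crossing (toℕ<n c) (toℕ<n j))
  potential-drop j (revShort c) = reverse-drop (toℕ c ℕ.≡ᵇ toℕ j) 1 (short-crossing (toℕ<n c) (toℕ<n j))

  Σlist-telescope : (w : Arc C → ℤ) (φ : ℕ → ℤ) → ∀ e es → Path C e es →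
    Σlist (λ a → w a + φ (tail C a) - φ (head C a)) (e ∷ es)
      ≡ Σlist w (e ∷ es) + φ (tail C e) - φ (head C (lastArc C e es))
  Σlist-telescope w φ e []       _            = shuffle (w e) (φ (tail C e)) (φ (head C e))
    where
    shuffle : ∀ x y z → x + y - z + 0ℤ ≡ x + 0ℤ + y - z
    shuffle = solve-∀
  Σlist-telescope w φ e (f ∷ fs) (e→f , path) rewrite Σlist-telescope w φ f fs path | e→f =
    shuffle (w e) (Σlist w (f ∷ fs)) (φ (tail C e)) (φ (tail C f)) (φ (head C (lastArc C f fs)))
    where
    shuffle : ∀ x S y z u → x + y - z + (S + z - u) ≡ x + S + y - u
    shuffle = solve-∀

  net-jumps : (Γ : Circuit C) (p : ℕ) → + (p ℕ.* n) ≡ totalLen C Γ →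
            ∀ j → Σlist (λ e → forwardJump e j - reverseJump e j) (arcs C Γ) ≡ + p
  net-jumps Γ p total j = *-cancelʳ-≡ _ _ (+ n) (begin
    Σlist σ (arcs C Γ) * + n
      ≡⟨ Σlist-*ʳ σ (+ n) (arcs C Γ) ⟨
    Σlist (λ e → σ e * + n) (arcs C Γ)
      ≡⟨ Σlist-cong (arcs C Γ) (potential-drop j) ⟨
    Σlist (λ e → len C e + φ (tail C e) - φ (head C e)) (arcs C Γ)
      ≡⟨ Σlist-telescope (len C) φ first rest path ⟩
    totalLen C Γ + φ (tail C first) - φ (head C (lastArc C first rest))
      ≡⟨ cong (λ v → totalLen C Γ + φ (tail C first) - φ v) closed ⟩
    totalLen C Γ + φ (tail C first) - φ (tail C first)
      ≡⟨ cancel (totalLen C Γ) (φ (tail C first)) ⟩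
    totalLen C Γ
      ≡⟨ total ⟨
    + (p ℕ.* n)
      ≡⟨ pos-* p n ⟩
    + p * + n ∎)
    where
    open ≡-Reasoning
    open Circuit Γ
    σ : Arc C → ℤ
    σ e = forwardJump e j - reverseJump e j
    φ : ℕ → ℤ
    φ = potential j
    cancel : ∀ x y → x + y - y ≡ x
    cancel = solve-∀

  forward-jumps : (Γ : Circuit C) (p : ℕ) → + (p ℕ.* n) ≡ totalLen C Γ →
                  ∀ j → Σlist (λ e → forwardJump e j) (arcs C Γ) ≡ pMinus C Γ j + + p
  forward-jumps Γ p total j =
    trans (Σlist-cong (arcs C Γ) (λ e → split (forwardJump e j) (reverseJump e j)))
          (trans (Σlist-+ (λ e → reverseJump e j) (λ e → forwardJump e j - reverseJump e j) (arcs C Γ))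
                 (cong (_+_ (pMinus C Γ j)) (net-jumps Γ p total j)))
    where
    split : ∀ x y → x ≡ y + (x - y)
    split = solve-∀

  rowDemand reverseRowDemand : (Fin m → ℕ) → Arc C → ℤ
  rowDemand b (fwdRow i) = + b i
  rowDemand b (revRow i) = - + b i
  rowDemand b _          = 0ℤ
  reverseRowDemand b (revRow i) = + b i
  reverseRowDemand b _          = 0ℤ

  -- The summands of tΓ and revRowB are local to Defs; unification only recovers them from a
  -- sum over a neutral list, hence the split on the first arc.
  tΓ≡Σ : ∀ b (Γ : Circuit C) → tΓ C Γ b ≡ Σlist (rowDemand b) (arcs C Γ)
  tΓ≡Σ b record { first = fwdRow i ; rest = es } =
    cong (_+_ (+ b i)) (Σlist-cong es λ { (fwdRow _) → refl ; (revRow _) → refl ; (fwdShort _) → refl ; (revShort _) → refl })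
  tΓ≡Σ b record { first = revRow i ; rest = es } =
    cong (_+_ (- + b i)) (Σlist-cong es λ { (fwdRow _) → refl ; (revRow _) → refl ; (fwdShort _) → refl ; (revShort _) → refl })
  tΓ≡Σ b record { first = fwdShort _ ; rest = es } =
    cong (_+_ 0ℤ) (Σlist-cong es λ { (fwdRow _) → refl ; (revRow _) → refl ; (fwdShort _) → refl ; (revShort _) → refl })
  tΓ≡Σ b record { first = revShort _ ; rest = es } =
    cong (_+_ 0ℤ) (Σlist-cong es λ { (fwdRow _) → refl ; (revRow _) → refl ; (fwdShort _) → refl ; (revShort _) → refl })

  revRowB≡Σ : ∀ b (Γ : Circuit C) → revRowB C Γ b ≡ Σlist (reverseRowDemand b) (arcs C Γ)
  revRowB≡Σ b record { first = fwdRow _ ; rest = es } =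
    cong (_+_ 0ℤ) (Σlist-cong es λ { (fwdRow _) → refl ; (revRow _) → refl ; (fwdShort _) → refl ; (revShort _) → refl })
  revRowB≡Σ b record { first = revRow i ; rest = es } =
    cong (_+_ (+ b i)) (Σlist-cong es λ { (fwdRow _) → refl ; (revRow _) → refl ; (fwdShort _) → refl ; (revShort _) → refl })
  revRowB≡Σ b record { first = fwdShort _ ; rest = es } =
    cong (_+_ 0ℤ) (Σlist-cong es λ { (fwdRow _) → refl ; (revRow _) → refl ; (fwdShort _) → refl ; (revShort _) → refl })
  revRowB≡Σ b record { first = revShort _ ; rest = es } =
    cong (_+_ 0ℤ) (Σlist-cong es λ { (fwdRow _) → refl ; (revRow _) → refl ; (fwdShort _) → refl ; (revShort _) → refl })

  module Weights (b : Fin m → ℕ) (x : Fin n → ℤ)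
                 (b≤Ax : ∀ i → + b i ≤ rowSum C x i) (0≤x : ∀ j → 0ℤ ≤ x j) where

    weight⁺ weight⁻ : Arc C → ℤ
    weight⁺ e = Σℤ (λ j → forwardJump e j * x j)
    weight⁻ e = Σℤ (λ j → reverseJump e j * x j)

    weight⁺-nonneg : ∀ e → 0ℤ ≤ weight⁺ e
    weight⁺-nonneg e = Σℤ-nonneg (λ j → *-nonneg (forwardJump-nonneg e j) (0≤x j))

    weight⁻-nonneg : ∀ e → 0ℤ ≤ weight⁻ e
    weight⁻-nonneg e = Σℤ-nonneg (λ j → *-nonneg (reverseJump-nonneg e j) (0≤x j))

    row-weight : ∀ i → + b i ≤ Σℤ (λ j → ⟦ entry C i j ⟧ * x j)
    row-weight i = ≤-trans (b≤Ax i) (≤-reflexive (Σℤ-cong (λ j → sym (select (entry C i j) (x j)))))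
      where
      select : ∀ J y → ⟦ J ⟧ * y ≡ (if J then y else 0ℤ)
      select true  y = *-identityˡ y
      select false y = refl

    demand≤weight⁺ : ∀ e → rowDemand b e + reverseRowDemand b e ≤ weight⁺ e
    demand≤weight⁺ (fwdRow i)   = ≤-trans (≤-reflexive (+-identityʳ (+ b i))) (row-weight i)
    demand≤weight⁺ (revRow i)   = ≤-trans (≤-reflexive (+-inverseˡ (+ b i))) (weight⁺-nonneg (revRow i))
    demand≤weight⁺ (fwdShort c) = weight⁺-nonneg (fwdShort c)
    demand≤weight⁺ (revShort c) = weight⁺-nonneg (revShort c)

    reverseDemand≤weight⁻ : ∀ e → reverseRowDemand b e ≤ weight⁻ e
    reverseDemand≤weight⁻ (fwdRow i)   = weight⁻-nonneg (fwdRow i)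
    reverseDemand≤weight⁻ (revRow i)   = row-weight i
    reverseDemand≤weight⁻ (fwdShort c) = weight⁻-nonneg (fwdShort c)
    reverseDemand≤weight⁻ (revShort c) = weight⁻-nonneg (revShort c)

    module _ (Γ : Circuit C) where
      R T : ℤ
      R = Σℤ (λ j → pMinus C Γ j * x j)
      T = Σℤ x

      revRowB≤R : revRowB C Γ b ≤ R
      revRowB≤R = begin
        revRowB C Γ b                            ≡⟨ revRowB≡Σ b Γ ⟩
        Σlist (reverseRowDemand b) (arcs C Γ)    ≤⟨ Σlist-mono (arcs C Γ) reverseDemand≤weight⁻ ⟩
        Σlist weight⁻ (arcs C Γ)                 ≡⟨ Σlist-Σℤ-weighted reverseJump x (arcs C Γ) ⟩
        R                                        ∎
        where open ≤-Reasoning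

      tΓ+revRowB≤R+pT : (p : ℕ) → + (p ℕ.* n) ≡ totalLen C Γ →
                        tΓ C Γ b + revRowB C Γ b ≤ R + + p * T
      tΓ+revRowB≤R+pT p total = begin
        tΓ C Γ b + revRowB C Γ b
          ≡⟨ cong₂ _+_ (tΓ≡Σ b Γ) (revRowB≡Σ b Γ) ⟩
        Σlist (rowDemand b) (arcs C Γ) + Σlist (reverseRowDemand b) (arcs C Γ)
          ≡⟨ Σlist-+ (rowDemand b) (reverseRowDemand b) (arcs C Γ) ⟨
        Σlist (λ e → rowDemand b e + reverseRowDemand b e) (arcs C Γ)
          ≤⟨ Σlist-mono (arcs C Γ) demand≤weight⁺ ⟩
        Σlist weight⁺ (arcs C Γ)
          ≡⟨ Σlist-Σℤ-weighted forwardJump x (arcs C Γ) ⟩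
        Σℤ (λ j → Σlist (λ e → forwardJump e j) (arcs C Γ) * x j)
          ≡⟨ Σℤ-cong (λ j → cong (_* x j) (forward-jumps Γ p total j)) ⟩
        Σℤ (λ j → (pMinus C Γ j + + p) * x j)
          ≡⟨ Σℤ-affine (pMinus C Γ) (+ p) x ⟩
        R + + p * T ∎
        where open ≤-Reasoning

theorem4p5 : {m n : ℕ} .{{_ : NonZero n}} (C : Circular m n) (b : Fin m → ℕ)
    (Γ : Circuit C) (p : ℕ) .{{_ : NonZero p}} →
    + (p ℕ.* n) ≡ totalLen C Γ →
    let t = tΓ C Γ b
        β = t /ℕ p
        r = + (t %ℕ p)
    in (x : Fin n → ℤ) → InQ C b x →
       r ℤ.* (β ℤ.+ + 1) ℤ.+ revRowB C Γ b
         ℤ.≤ Σℤ (λ j → (pMinus C Γ j ℤ.+ r) ℤ.* x j)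
theorem4p5 {n = ℕ.suc n′} C b Γ p total x (b≤Ax , 0≤x) =
  subst (_ ℤ.≤_) (sym (Σℤ-affine (pMinus C Γ) _ x))
        (mixed-integer-rounding p {tΓ C Γ b} (revRowB≤R Γ) (tΓ+revRowB≤R+pT Γ p total))
  where
  open Crossings C
  open IntegerRounding using (mixed-integer-rounding)
  open IntegerSums using (Σℤ-affine)
  open Weights b x b≤Ax 0≤x
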